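{- Let $\phi$ be a tree-compatible linear endomorphism of $D_E\otimes D_V$. (1) For every polynomial $P\in\mathbb{K}[X]$, $P(\phi)$ is tree-compatible. (2) If moreover $\phi$ is locally nilpotent, i.e. for every $x\in D_E\otimes D_V$ there is $n\geq1$ with $\phi^n(x)=0$, then for every formal power series $P\in\mathbb{K}[[X]]$, $P(\phi)$ is tree-compatible.
   Context: $\mathbb{K}$ is a field of characteristic zero; $D_E,D_V$ are vector spaces. For a linear $\phi:D_E\otimes D_V\to D_E\otimes D_V$, with $\tau$ the flip of $D_E\otimes D_E$, define on $D_E\otimes D_E\otimes D_V$: $\phi_{23}=\mathrm{Id}_{D_E}\otimes\phi$ and $\phi_{13}=(\tau\otimes\mathrm{Id}_{D_V})\circ(\mathrm{Id}_{D_E}\otimes\phi)\circ(\tau\otimes\mathrm{Id}_{D_V})$. $\phi$ is tree-compatible if $\phi_{13}\circ\phi_{23}=\phi_{23}\circ\phi_{13}$. For a locally nilpotent $\phi$ and $P=\sum_k p_kX^k\in\mathbb{K}[[X]]$, $P(\phi)(x)=\sum_k p_k\phi^k(x)$ (a finite sum for each $x$). -}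

module Defs where

open import Level using (Level; _⊔_)
open import Algebra.Bundles using (CommutativeRing)
open import Algebra.Module.Bundles using (Module)
open import Data.Nat using (ℕ; zero; suc; _≤_)
open import Data.List using (List; []; _∷_; _++_; map; concatMap)
open import Data.Product using (_×_; _,_; ∃-syntax; proj₁)
open import Relation.Nullary using (¬_)

private
  variable
    r ℓr m ℓm n ℓn : Level

module _ (K : CommutativeRing r ℓr) where
  open CommutativeRing K

  IsField : Set (r ⊔ ℓr)
  IsField = (¬ (1# ≈ 0#)) × (∀ x → ¬ (x ≈ 0#) → ∃[ y ] (x * y ≈ 1#))

  _·1 : ℕ → Carrier
  zero  ·1 = 0#
  suc k ·1 = 1# + (k ·1)

  CharZero : Set ℓr
  CharZero = ∀ k → ¬ ((suc k) ·1 ≈ 0#)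

-- Tensor products D_E ⊗ D_V and D_E ⊗ D_E ⊗ D_V over K, constructed as
-- formal finite sums of pure tensors (lists) modulo the congruence
-- generated by (multi)linearity and balancing of scalars.

module Tensor (K : CommutativeRing r ℓr) (E : Module K m ℓm) (V : Module K n ℓn) where
  open CommutativeRing K using (Carrier)
  private
    module E = Module E
    module V = Module V

  -- D_E ⊗ D_V ; a list [(e₁,v₁),…,(e_k,v_k)] stands for Σ eᵢ ⊗ vᵢ
  T₂ : Set (m ⊔ n)
  T₂ = List (E.Carrierᴹ × V.Carrierᴹ)

  infix 4 _∼_
  data _∼_ : T₂ → T₂ → Set (r ⊔ m ⊔ n ⊔ ℓm ⊔ ℓn) where
    ∼-refl  : ∀ {xs} → xs ∼ xs
    ∼-sym   : ∀ {xs ys} → xs ∼ ys → ys ∼ xs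
    ∼-trans : ∀ {xs ys zs} → xs ∼ ys → ys ∼ zs → xs ∼ zs
    ∼-++    : ∀ {xs ys us ws} → xs ∼ ys → us ∼ ws → xs ++ us ∼ ys ++ ws
    ∼-comm  : ∀ {xs ys} → xs ++ ys ∼ ys ++ xs
    ∼-pure  : ∀ {e e' v v'} → e E.≈ᴹ e' → v V.≈ᴹ v' → (e , v) ∷ [] ∼ (e' , v') ∷ []
    ∼-zero  : ∀ {v} → (E.0ᴹ , v) ∷ [] ∼ []
    ∼-addˡ  : ∀ {e e' v} → (e E.+ᴹ e' , v) ∷ [] ∼ (e , v) ∷ (e' , v) ∷ []
    ∼-addʳ  : ∀ {e v v'} → (e , v V.+ᴹ v') ∷ [] ∼ (e , v) ∷ (e , v') ∷ []
    ∼-scal  : ∀ {c e v} → (c E.*ₗ e , v) ∷ [] ∼ (e , c V.*ₗ v) ∷ []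

  infixr 7 _⊙_
  _⊙_ : Carrier → T₂ → T₂
  c ⊙ xs = map (λ { (e , v) → (c E.*ₗ e , v) }) xs

  T₃ : Set (m ⊔ n)
  T₃ = List (E.Carrierᴹ × E.Carrierᴹ × V.Carrierᴹ)

  infix 4 _∼₃_
  data _∼₃_ : T₃ → T₃ → Set (r ⊔ m ⊔ n ⊔ ℓm ⊔ ℓn) where
    ∼-refl  : ∀ {xs} → xs ∼₃ xs
    ∼-sym   : ∀ {xs ys} → xs ∼₃ ys → ys ∼₃ xs
    ∼-trans : ∀ {xs ys zs} → xs ∼₃ ys → ys ∼₃ zs → xs ∼₃ zs
    ∼-++    : ∀ {xs ys us ws} → xs ∼₃ ys → us ∼₃ ws → xs ++ us ∼₃ ys ++ ws
    ∼-comm  : ∀ {xs ys} → xs ++ ys ∼₃ ys ++ xs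
    ∼-pure  : ∀ {a a' b b' v v'} → a E.≈ᴹ a' → b E.≈ᴹ b' → v V.≈ᴹ v' →
              (a , b , v) ∷ [] ∼₃ (a' , b' , v') ∷ []
    ∼-zero  : ∀ {b v} → (E.0ᴹ , b , v) ∷ [] ∼₃ []
    ∼-add₁  : ∀ {a a' b v} → (a E.+ᴹ a' , b , v) ∷ [] ∼₃ (a , b , v) ∷ (a' , b , v) ∷ []
    ∼-add₂  : ∀ {a b b' v} → (a , b E.+ᴹ b' , v) ∷ [] ∼₃ (a , b , v) ∷ (a , b' , v) ∷ []
    ∼-add₃  : ∀ {a b v v'} → (a , b , v V.+ᴹ v') ∷ [] ∼₃ (a , b , v) ∷ (a , b , v') ∷ []
    ∼-scal₁₂ : ∀ {c a b v} → (c E.*ₗ a , b , v) ∷ [] ∼₃ (a , c E.*ₗ b , v) ∷ []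
    ∼-scal₁₃ : ∀ {c a b v} → (c E.*ₗ a , b , v) ∷ [] ∼₃ (a , b , c V.*ₗ v) ∷ []

  record LinearEndo : Set (r ⊔ m ⊔ n ⊔ ℓm ⊔ ℓn) where
    field
      fun   : T₂ → T₂
      cong  : ∀ {xs ys} → xs ∼ ys → fun xs ∼ fun ys
      +-hom : ∀ xs ys → fun (xs ++ ys) ∼ fun xs ++ fun ys
      *-hom : ∀ c xs → fun (c ⊙ xs) ∼ c ⊙ fun xs

  -- φ₂₃ = Id ⊗ φ, and φ₁₃ = (τ ⊗ Id) ∘ (Id ⊗ φ) ∘ (τ ⊗ Id),
  -- given on pure tensors and extended additively (valid for linear f):
  --   φ₂₃ (a ⊗ b ⊗ v) = a ⊗ φ(b ⊗ v)
  --   φ₁₃ (a ⊗ b ⊗ v) = (τ ⊗ Id)(b ⊗ φ(a ⊗ v)),  i.e. Σ e ⊗ b ⊗ w  where φ(a ⊗ v) = Σ e ⊗ w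
  _₂₃ : (T₂ → T₂) → T₃ → T₃
  (f ₂₃) = concatMap (λ { (a , b , v) → map (λ { (e , w) → (a , e , w) }) (f ((b , v) ∷ [])) })

  _₁₃ : (T₂ → T₂) → T₃ → T₃
  (f ₁₃) = concatMap (λ { (a , b , v) → map (λ { (e , w) → (e , b , w) }) (f ((a , v) ∷ [])) })

  TreeCompatible : (T₂ → T₂) → Set (r ⊔ m ⊔ n ⊔ ℓm ⊔ ℓn)
  TreeCompatible f = ∀ t → (f ₁₃) ((f ₂₃) t) ∼₃ (f ₂₃) ((f ₁₃) t)

  iter : (T₂ → T₂) → ℕ → T₂ → T₂
  iter f zero    x = x
  iter f (suc k) x = f (iter f k x)

  -- P(f) for a polynomial P = p₀ + p₁X + … given by its coefficient list [p₀, p₁, …]: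
  -- P(f)(x) = Σ_k p_k f^k(x)
  evalPoly : List Carrier → (T₂ → T₂) → T₂ → T₂
  evalPoly []       f x = []
  evalPoly (p ∷ ps) f x = (p ⊙ x) ++ evalPoly ps f (f x)

  partialSum : (ℕ → Carrier) → ℕ → (T₂ → T₂) → T₂ → T₂
  partialSum P zero    f x = []
  partialSum P (suc N) f x = (P 0 ⊙ x) ++ partialSum (λ k → P (suc k)) N f (f x)

  LocallyNilpotent : (T₂ → T₂) → Set (r ⊔ m ⊔ n ⊔ ℓm ⊔ ℓn)
  LocallyNilpotent f = ∀ x → ∃[ k ] (1 ≤ k × iter f k x ∼ [])

  -- P(f)(x) = Σ_k p_k f^k(x), a finite sum: truncated at the witnessed nilpotency index
  evalSeries : (ℕ → Carrier) → (f : T₂ → T₂) → LocallyNilpotent f → T₂ → T₂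
  evalSeries P f nil x = partialSum P (proj₁ (nil x)) f x

-- Both φ₂₃ and φ₁₃ are linear maps of D_E ⊗ D_E ⊗ D_V, and evaluation commutes with the
-- constructions: Q(φ)₂₃ = Q(φ₂₃) and Q(φ)₁₃ = Q(φ₁₃) for every polynomial Q (the second follows
-- from the first by conjugating with τ ⊗ Id). Polynomials in two commuting linear maps commute,
-- which gives (1). For locally nilpotent φ, one instance of the identity for P(φ) only evaluates
-- P(φ) on finitely many pure tensors, where it agrees with a single truncation of P; so (2)
-- reduces to the argument for (1).
module Submission where

open import Defs
open import Level using (Level)
open import Algebra.Bundles using (CommutativeRing)
open import Algebra.Module.Bundles using (Module)
open import Data.Nat using (ℕ; zero; suc; _≤_; _⊔_; z≤n; s≤s)
open import Data.Nat.Properties using (≤-refl; m⊔n≤o⇒m≤o; m⊔n≤o⇒n≤o)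
open import Data.List using (List; []; _∷_; _++_; map; applyUpTo)
open import Data.List.Properties
  using (map-++; map-∘; ++-assoc; concatMap-++; concatMap-cong; concatMap-map; map-concatMap)
open import Data.Product using (_×_; _,_; proj₁; proj₂)
open import Function using (_∘_)
open import Relation.Binary.Bundles using (Setoid)
open import Relation.Binary.PropositionalEquality as ≡ using (_≡_; refl)
import Relation.Binary.Reasoning.Setoid as SetoidReasoning

module TreeCompatibility {r ℓr m ℓm n ℓn : Level} (K : CommutativeRing r ℓr)
  (E : Module K m ℓm) (V : Module K n ℓn) where

  open Tensor K E V
  open CommutativeRing K using (Carrier; 0#) renaming (refl to ≈-refl)
  private
    module E = Module E
    module V = Module V

  T₃-setoid : Setoid _ _
  T₃-setoid = record
    { Carrier = T₃ ; _≈_ = _∼₃_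
    ; isEquivalence = record { refl = ∼-refl ; sym = ∼-sym ; trans = ∼-trans } }

  open SetoidReasoning T₃-setoid

  ≡⇒∼ : ∀ {xs ys} → xs ≡ ys → xs ∼ ys
  ≡⇒∼ refl = ∼-refl

  ≡⇒∼₃ : ∀ {xs ys} → xs ≡ ys → xs ∼₃ ys
  ≡⇒∼₃ refl = ∼-refl

  ++-interchange : ∀ w x y z → (w ++ x) ++ (y ++ z) ∼₃ (w ++ y) ++ (x ++ z)
  ++-interchange w x y z = begin
    (w ++ x) ++ (y ++ z)   ≡⟨ ++-assoc w x (y ++ z) ⟩
    w ++ x ++ y ++ z       ≡⟨ ≡.cong (w ++_) (≡.sym (++-assoc x y z)) ⟩
    w ++ ((x ++ y) ++ z)   ≈⟨ ∼-++ (∼-refl {xs = w}) (∼-++ (∼-comm {xs = x}) ∼-refl) ⟩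
    w ++ ((y ++ x) ++ z)   ≡⟨ ≡.cong (w ++_) (++-assoc y x z) ⟩
    w ++ y ++ x ++ z       ≡⟨ ≡.sym (++-assoc w y (x ++ z)) ⟩
    (w ++ y) ++ (x ++ z)   ∎

  ++-[]-split : ∀ {x} p q → x ∼₃ p ++ q → x ++ [] ∼₃ p ++ (q ++ [])
  ++-[]-split p q x∼p++q = ∼-trans (∼-++ x∼p++q ∼-refl) (≡⇒∼₃ (++-assoc p q []))

  *ₗ-swap : ∀ c d e → c E.*ₗ (d E.*ₗ e) E.≈ᴹ d E.*ₗ (c E.*ₗ e)
  *ₗ-swap c d e = E.≈ᴹ-trans (E.≈ᴹ-sym (E.*ₗ-assoc c d e))
    (E.≈ᴹ-trans (E.*ₗ-cong (CommutativeRing.*-comm K c d) E.≈ᴹ-refl) (E.*ₗ-assoc d c e))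

  ⊙-cong : ∀ c {xs ys} → xs ∼ ys → c ⊙ xs ∼ c ⊙ ys
  ⊙-cong c ∼-refl = ∼-refl
  ⊙-cong c (∼-sym p) = ∼-sym (⊙-cong c p)
  ⊙-cong c (∼-trans p q) = ∼-trans (⊙-cong c p) (⊙-cong c q)
  ⊙-cong c (∼-++ {xs} {ys} {us} {ws} p q) = ∼-trans (≡⇒∼ (map-++ _ xs us))
    (∼-trans (∼-++ (⊙-cong c p) (⊙-cong c q)) (≡⇒∼ (≡.sym (map-++ _ ys ws))))
  ⊙-cong c (∼-comm {xs} {ys}) = ∼-trans (≡⇒∼ (map-++ _ xs ys))
    (∼-trans (∼-comm {xs = c ⊙ xs}) (≡⇒∼ (≡.sym (map-++ _ ys xs))))
  ⊙-cong c (∼-pure p q) = ∼-pure (E.*ₗ-cong ≈-refl p) q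
  ⊙-cong c ∼-zero = ∼-trans (∼-pure (E.*ₗ-zeroʳ c) V.≈ᴹ-refl) ∼-zero
  ⊙-cong c (∼-addˡ {e} {e'}) = ∼-trans (∼-pure (E.*ₗ-distribˡ c e e') V.≈ᴹ-refl) ∼-addˡ
  ⊙-cong c ∼-addʳ = ∼-addʳ
  ⊙-cong c (∼-scal {d} {e}) = ∼-trans (∼-pure (*ₗ-swap c d e) V.≈ᴹ-refl) ∼-scal

  ⊙-zeroˡ : ∀ xs → 0# ⊙ xs ∼ []
  ⊙-zeroˡ [] = ∼-refl
  ⊙-zeroˡ ((e , v) ∷ xs) = ∼-++ (∼-trans (∼-pure (E.*ₗ-zeroˡ e) V.≈ᴹ-refl) ∼-zero) (⊙-zeroˡ xs)

  infixr 7 _⊙₃_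
  _⊙₃_ : Carrier → T₃ → T₃
  c ⊙₃ t = map (λ { (a , b , v) → (c E.*ₗ a , b , v) }) t

  ⊙₃-++ : ∀ c xs ys → c ⊙₃ (xs ++ ys) ≡ c ⊙₃ xs ++ c ⊙₃ ys
  ⊙₃-++ c = map-++ _

  ⊙₃-cong : ∀ c {xs ys} → xs ∼₃ ys → c ⊙₃ xs ∼₃ c ⊙₃ ys
  ⊙₃-cong c ∼-refl = ∼-refl
  ⊙₃-cong c (∼-sym p) = ∼-sym (⊙₃-cong c p)
  ⊙₃-cong c (∼-trans p q) = ∼-trans (⊙₃-cong c p) (⊙₃-cong c q)
  ⊙₃-cong c (∼-++ {xs} {ys} {us} {ws} p q) = begin
    c ⊙₃ (xs ++ us)         ≡⟨ ⊙₃-++ c xs us ⟩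
    c ⊙₃ xs ++ c ⊙₃ us      ≈⟨ ∼-++ (⊙₃-cong c p) (⊙₃-cong c q) ⟩
    c ⊙₃ ys ++ c ⊙₃ ws      ≡⟨ ⊙₃-++ c ys ws ⟨
    c ⊙₃ (ys ++ ws)         ∎
  ⊙₃-cong c (∼-comm {xs} {ys}) = begin
    c ⊙₃ (xs ++ ys)         ≡⟨ ⊙₃-++ c xs ys ⟩
    c ⊙₃ xs ++ c ⊙₃ ys      ≈⟨ ∼-comm {xs = c ⊙₃ xs} ⟩
    c ⊙₃ ys ++ c ⊙₃ xs      ≡⟨ ⊙₃-++ c ys xs ⟨
    c ⊙₃ (ys ++ xs)         ∎
  ⊙₃-cong c (∼-pure p q s) = ∼-pure (E.*ₗ-cong ≈-refl p) q s
  ⊙₃-cong c ∼-zero = ∼-trans (∼-pure (E.*ₗ-zeroʳ c) E.≈ᴹ-refl V.≈ᴹ-refl) ∼-zero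
  ⊙₃-cong c (∼-add₁ {a} {a'}) = ∼-trans (∼-pure (E.*ₗ-distribˡ c a a') E.≈ᴹ-refl V.≈ᴹ-refl) ∼-add₁
  ⊙₃-cong c ∼-add₂ = ∼-add₂
  ⊙₃-cong c ∼-add₃ = ∼-add₃
  ⊙₃-cong c (∼-scal₁₂ {d} {a}) = ∼-trans (∼-pure (*ₗ-swap c d a) E.≈ᴹ-refl V.≈ᴹ-refl) ∼-scal₁₂
  ⊙₃-cong c (∼-scal₁₃ {d} {a}) = ∼-trans (∼-pure (*ₗ-swap c d a) E.≈ᴹ-refl V.≈ᴹ-refl) ∼-scal₁₃

  ⊙₃-zeroˡ : ∀ xs → 0# ⊙₃ xs ∼₃ []
  ⊙₃-zeroˡ [] = ∼-refl
  ⊙₃-zeroˡ ((a , b , v) ∷ xs) =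
    ∼-++ (∼-trans (∼-pure (E.*ₗ-zeroˡ a) E.≈ᴹ-refl V.≈ᴹ-refl) ∼-zero) (⊙₃-zeroˡ xs)

  ⊙₃-comm : ∀ c d xs → c ⊙₃ d ⊙₃ xs ∼₃ d ⊙₃ c ⊙₃ xs
  ⊙₃-comm c d [] = ∼-refl
  ⊙₃-comm c d ((a , b , v) ∷ xs) =
    ∼-++ (∼-pure (*ₗ-swap c d a) E.≈ᴹ-refl V.≈ᴹ-refl) (⊙₃-comm c d xs)

  record IsLinear₃ (G : T₃ → T₃) : Set (r Level.⊔ m Level.⊔ n Level.⊔ ℓm Level.⊔ ℓn) where
    field
      cong  : ∀ {xs ys} → xs ∼₃ ys → G xs ∼₃ G ys
      +-hom : ∀ xs ys → G (xs ++ ys) ∼₃ G xs ++ G ys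
      *-hom : ∀ c xs → G (c ⊙₃ xs) ∼₃ c ⊙₃ G xs

    []-hom : G [] ∼₃ []
    []-hom = ∼-trans (*-hom 0# []) (⊙₃-zeroˡ (G []))

  open IsLinear₃

  IsLinear₃-resp : ∀ {G H} → (∀ t → G t ∼₃ H t) → IsLinear₃ G → IsLinear₃ H
  IsLinear₃-resp {G} {H} G∼H lin = record
    { cong  = λ {xs} {ys} p → ∼-trans (∼-sym (G∼H xs)) (∼-trans (cong lin p) (G∼H ys))
    ; +-hom = λ xs ys → ∼-trans (∼-sym (G∼H (xs ++ ys)))
                          (∼-trans (+-hom lin xs ys) (∼-++ (G∼H xs) (G∼H ys)))
    ; *-hom = λ c xs → ∼-trans (∼-sym (G∼H (c ⊙₃ xs)))
                          (∼-trans (*-hom lin c xs) (⊙₃-cong c (G∼H xs)))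
    }

  poly₃ : List Carrier → (T₃ → T₃) → T₃ → T₃
  poly₃ []       G t = []
  poly₃ (c ∷ cs) G t = c ⊙₃ t ++ poly₃ cs G (G t)

  poly₃-linear : ∀ {G} cs → IsLinear₃ G → IsLinear₃ (poly₃ cs G)
  poly₃-linear [] lin = record
    { cong = λ _ → ∼-refl ; +-hom = λ _ _ → ∼-refl ; *-hom = λ _ _ → ∼-refl }
  poly₃-linear {G} (c ∷ cs) lin = record
    { cong  = λ p → ∼-++ (⊙₃-cong c p) (cong rest (cong lin p))
    ; +-hom = λ xs ys → begin
        c ⊙₃ (xs ++ ys) ++ poly₃ cs G (G (xs ++ ys))
          ≈⟨ ∼-++ (≡⇒∼₃ (⊙₃-++ c xs ys)) (cong rest (+-hom lin xs ys)) ⟩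
        (c ⊙₃ xs ++ c ⊙₃ ys) ++ poly₃ cs G (G xs ++ G ys)
          ≈⟨ ∼-++ (∼-refl {xs = c ⊙₃ xs ++ c ⊙₃ ys}) (+-hom rest (G xs) (G ys)) ⟩
        (c ⊙₃ xs ++ c ⊙₃ ys) ++ (poly₃ cs G (G xs) ++ poly₃ cs G (G ys))
          ≈⟨ ++-interchange (c ⊙₃ xs) (c ⊙₃ ys) _ _ ⟩
        (c ⊙₃ xs ++ poly₃ cs G (G xs)) ++ (c ⊙₃ ys ++ poly₃ cs G (G ys)) ∎
    ; *-hom = λ d xs → begin
        c ⊙₃ d ⊙₃ xs ++ poly₃ cs G (G (d ⊙₃ xs))
          ≈⟨ ∼-++ (⊙₃-comm c d xs) (cong rest (*-hom lin d xs)) ⟩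
        d ⊙₃ c ⊙₃ xs ++ poly₃ cs G (d ⊙₃ G xs)
          ≈⟨ ∼-++ (∼-refl {xs = d ⊙₃ c ⊙₃ xs}) (*-hom rest d (G xs)) ⟩
        d ⊙₃ c ⊙₃ xs ++ d ⊙₃ poly₃ cs G (G xs)
          ≡⟨ ⊙₃-++ d (c ⊙₃ xs) _ ⟨
        d ⊙₃ (c ⊙₃ xs ++ poly₃ cs G (G xs)) ∎
    }
    where
      rest : IsLinear₃ (poly₃ cs G)
      rest = poly₃-linear cs lin

  poly₃-commute : ∀ {G H} → IsLinear₃ G → IsLinear₃ H → (∀ t → G (H t) ∼₃ H (G t)) →
                  ∀ cs t → G (poly₃ cs H t) ∼₃ poly₃ cs H (G t)
  poly₃-commute linG linH GH∼HG []       t = []-hom linG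
  poly₃-commute {G} {H} linG linH GH∼HG (c ∷ cs) t = begin
    G (c ⊙₃ t ++ poly₃ cs H (H t))      ≈⟨ +-hom linG (c ⊙₃ t) _ ⟩
    G (c ⊙₃ t) ++ G (poly₃ cs H (H t))  ≈⟨ ∼-++ (*-hom linG c t) (poly₃-commute linG linH GH∼HG cs (H t)) ⟩
    c ⊙₃ G t ++ poly₃ cs H (G (H t))    ≈⟨ ∼-++ (∼-refl {xs = c ⊙₃ G t}) (cong (poly₃-linear cs linH) (GH∼HG t)) ⟩
    c ⊙₃ G t ++ poly₃ cs H (H (G t))    ∎

  poly₃-poly₃-commute : ∀ {G H} → IsLinear₃ G → IsLinear₃ H → (∀ t → G (H t) ∼₃ H (G t)) →
                        ∀ cs ds t → poly₃ ds G (poly₃ cs H t) ∼₃ poly₃ cs H (poly₃ ds G t)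
  poly₃-poly₃-commute linG linH GH∼HG cs ds =
    poly₃-commute (poly₃-linear ds linG) linH
      (λ t → ∼-sym (poly₃-commute linH linG (λ s → ∼-sym (GH∼HG s)) ds t)) cs

  ∼-zero₂ : ∀ {a v} → (a , E.0ᴹ , v) ∷ [] ∼₃ []
  ∼-zero₂ {a} {v} = begin
    (a , E.0ᴹ , v) ∷ []               ≈⟨ ∼-pure E.≈ᴹ-refl (E.≈ᴹ-sym (E.*ₗ-zeroˡ E.0ᴹ)) V.≈ᴹ-refl ⟩
    (a , 0# E.*ₗ E.0ᴹ , v) ∷ []       ≈⟨ ∼-sym ∼-scal₁₂ ⟩
    (0# E.*ₗ a , E.0ᴹ , v) ∷ []       ≈⟨ ∼-pure (E.*ₗ-zeroˡ a) E.≈ᴹ-refl V.≈ᴹ-refl ⟩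
    (E.0ᴹ , E.0ᴹ , v) ∷ []            ≈⟨ ∼-zero ⟩
    []                                ∎

  swap₁₂ : T₃ → T₃
  swap₁₂ = map (λ { (a , b , v) → (b , a , v) })

  swap₁₂-involutive : ∀ t → swap₁₂ (swap₁₂ t) ≡ t
  swap₁₂-involutive []      = refl
  swap₁₂-involutive (x ∷ t) = ≡.cong (x ∷_) (swap₁₂-involutive t)

  swap₁₂-++ : ∀ xs ys → swap₁₂ (xs ++ ys) ≡ swap₁₂ xs ++ swap₁₂ ys
  swap₁₂-++ = map-++ _

  swap₁₂-cong : ∀ {xs ys} → xs ∼₃ ys → swap₁₂ xs ∼₃ swap₁₂ ys
  swap₁₂-cong ∼-refl = ∼-refl
  swap₁₂-cong (∼-sym p) = ∼-sym (swap₁₂-cong p)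
  swap₁₂-cong (∼-trans p q) = ∼-trans (swap₁₂-cong p) (swap₁₂-cong q)
  swap₁₂-cong (∼-++ {xs} {ys} {us} {ws} p q) = begin
    swap₁₂ (xs ++ us)           ≡⟨ swap₁₂-++ xs us ⟩
    swap₁₂ xs ++ swap₁₂ us      ≈⟨ ∼-++ (swap₁₂-cong p) (swap₁₂-cong q) ⟩
    swap₁₂ ys ++ swap₁₂ ws      ≡⟨ swap₁₂-++ ys ws ⟨
    swap₁₂ (ys ++ ws)           ∎
  swap₁₂-cong (∼-comm {xs} {ys}) = begin
    swap₁₂ (xs ++ ys)           ≡⟨ swap₁₂-++ xs ys ⟩
    swap₁₂ xs ++ swap₁₂ ys      ≈⟨ ∼-comm {xs = swap₁₂ xs} ⟩
    swap₁₂ ys ++ swap₁₂ xs      ≡⟨ swap₁₂-++ ys xs ⟨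
    swap₁₂ (ys ++ xs)           ∎
  swap₁₂-cong (∼-pure p q s) = ∼-pure q p s
  swap₁₂-cong ∼-zero = ∼-zero₂
  swap₁₂-cong ∼-add₁ = ∼-add₂
  swap₁₂-cong ∼-add₂ = ∼-add₁
  swap₁₂-cong ∼-add₃ = ∼-add₃
  swap₁₂-cong ∼-scal₁₂ = ∼-sym ∼-scal₁₂
  swap₁₂-cong ∼-scal₁₃ = ∼-trans (∼-sym ∼-scal₁₂) ∼-scal₁₃

  swap₁₂-⊙₃ : ∀ c t → swap₁₂ (c ⊙₃ t) ∼₃ c ⊙₃ swap₁₂ t
  swap₁₂-⊙₃ c []      = ∼-refl
  swap₁₂-⊙₃ c (x ∷ t) = ∼-++ (∼-sym ∼-scal₁₂) (swap₁₂-⊙₃ c t)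

  ₁₃≡swap₁₂-₂₃-swap₁₂ : ∀ g t → (g ₁₃) t ≡ swap₁₂ ((g ₂₃) (swap₁₂ t))
  ₁₃≡swap₁₂-₂₃-swap₁₂ g t = ≡.sym (≡.trans (map-concatMap _ _ (swap₁₂ t))
    (≡.trans (concatMap-map _ _ t) (concatMap-cong (λ _ → ≡.sym (map-∘ _)) t)))

  swap₁₂-conj-linear : ∀ {G} → IsLinear₃ G → IsLinear₃ (swap₁₂ ∘ G ∘ swap₁₂)
  swap₁₂-conj-linear {G} lin = record
    { cong  = swap₁₂-cong ∘ cong lin ∘ swap₁₂-cong
    ; +-hom = λ xs ys → begin
        swap₁₂ (G (swap₁₂ (xs ++ ys)))                     ≡⟨ ≡.cong (swap₁₂ ∘ G) (swap₁₂-++ xs ys) ⟩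
        swap₁₂ (G (swap₁₂ xs ++ swap₁₂ ys))                ≈⟨ swap₁₂-cong (+-hom lin _ _) ⟩
        swap₁₂ (G (swap₁₂ xs) ++ G (swap₁₂ ys))            ≡⟨ swap₁₂-++ (G (swap₁₂ xs)) _ ⟩
        swap₁₂ (G (swap₁₂ xs)) ++ swap₁₂ (G (swap₁₂ ys))   ∎
    ; *-hom = λ c xs → begin
        swap₁₂ (G (swap₁₂ (c ⊙₃ xs)))   ≈⟨ swap₁₂-cong (cong lin (swap₁₂-⊙₃ c xs)) ⟩
        swap₁₂ (G (c ⊙₃ swap₁₂ xs))     ≈⟨ swap₁₂-cong (*-hom lin c _) ⟩
        swap₁₂ (c ⊙₃ G (swap₁₂ xs))     ≈⟨ swap₁₂-⊙₃ c _ ⟩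
        c ⊙₃ swap₁₂ (G (swap₁₂ xs))     ∎
    }

  ₁₃-linear : ∀ g → IsLinear₃ (g ₂₃) → IsLinear₃ (g ₁₃)
  ₁₃-linear g lin =
    IsLinear₃-resp (λ t → ≡⇒∼₃ (≡.sym (₁₃≡swap₁₂-₂₃-swap₁₂ g t))) (swap₁₂-conj-linear lin)

  poly₃-swap₁₂-conj : ∀ {G H} → (∀ t → H t ≡ swap₁₂ (G (swap₁₂ t))) →
                      ∀ cs t → poly₃ cs H t ∼₃ swap₁₂ (poly₃ cs G (swap₁₂ t))
  poly₃-swap₁₂-conj H≡ []       t = ∼-refl
  poly₃-swap₁₂-conj {G} {H} H≡ (c ∷ cs) t = begin
    c ⊙₃ t ++ poly₃ cs H (H t)
      ≈⟨ ∼-++ (∼-refl {xs = c ⊙₃ t}) (poly₃-swap₁₂-conj H≡ cs (H t)) ⟩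
    c ⊙₃ t ++ swap₁₂ (poly₃ cs G (swap₁₂ (H t)))
      ≡⟨ ≡.cong (λ s → c ⊙₃ t ++ swap₁₂ (poly₃ cs G s))
           (≡.trans (≡.cong swap₁₂ (H≡ t)) (swap₁₂-involutive _)) ⟩
    c ⊙₃ t ++ swap₁₂ (poly₃ cs G (G (swap₁₂ t)))
      ≡⟨ ≡.cong (λ s → c ⊙₃ s ++ swap₁₂ (poly₃ cs G (G (swap₁₂ t)))) (swap₁₂-involutive t) ⟨
    c ⊙₃ swap₁₂ (swap₁₂ t) ++ swap₁₂ (poly₃ cs G (G (swap₁₂ t)))
      ≈⟨ ∼-++ (∼-sym (swap₁₂-⊙₃ c (swap₁₂ t))) ∼-refl ⟩
    swap₁₂ (c ⊙₃ swap₁₂ t) ++ swap₁₂ (poly₃ cs G (G (swap₁₂ t)))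
      ≡⟨ swap₁₂-++ (c ⊙₃ swap₁₂ t) _ ⟨
    swap₁₂ (c ⊙₃ swap₁₂ t ++ poly₃ cs G (G (swap₁₂ t))) ∎

  infixr 8 _⊗_
  _⊗_ : E.Carrierᴹ → T₂ → T₃
  a ⊗ xs = map (λ { (e , w) → (a , e , w) }) xs

  ⊗-++ : ∀ a xs ys → a ⊗ (xs ++ ys) ≡ a ⊗ xs ++ a ⊗ ys
  ⊗-++ a = map-++ _

  ⊗-congˡ : ∀ {a a'} → a E.≈ᴹ a' → ∀ xs → a ⊗ xs ∼₃ a' ⊗ xs
  ⊗-congˡ p []      = ∼-refl
  ⊗-congˡ p (x ∷ xs) = ∼-++ (∼-pure p E.≈ᴹ-refl V.≈ᴹ-refl) (⊗-congˡ p xs)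

  ⊗-congʳ : ∀ a {xs ys} → xs ∼ ys → a ⊗ xs ∼₃ a ⊗ ys
  ⊗-congʳ a ∼-refl = ∼-refl
  ⊗-congʳ a (∼-sym p) = ∼-sym (⊗-congʳ a p)
  ⊗-congʳ a (∼-trans p q) = ∼-trans (⊗-congʳ a p) (⊗-congʳ a q)
  ⊗-congʳ a (∼-++ {xs} {ys} {us} {ws} p q) = begin
    a ⊗ (xs ++ us)       ≡⟨ ⊗-++ a xs us ⟩
    a ⊗ xs ++ a ⊗ us     ≈⟨ ∼-++ (⊗-congʳ a p) (⊗-congʳ a q) ⟩
    a ⊗ ys ++ a ⊗ ws     ≡⟨ ⊗-++ a ys ws ⟨
    a ⊗ (ys ++ ws)       ∎
  ⊗-congʳ a (∼-comm {xs} {ys}) = begin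
    a ⊗ (xs ++ ys)       ≡⟨ ⊗-++ a xs ys ⟩
    a ⊗ xs ++ a ⊗ ys     ≈⟨ ∼-comm {xs = a ⊗ xs} ⟩
    a ⊗ ys ++ a ⊗ xs     ≡⟨ ⊗-++ a ys xs ⟨
    a ⊗ (ys ++ xs)       ∎
  ⊗-congʳ a (∼-pure p q) = ∼-pure E.≈ᴹ-refl p q
  ⊗-congʳ a ∼-zero = ∼-zero₂
  ⊗-congʳ a ∼-addˡ = ∼-add₂
  ⊗-congʳ a ∼-addʳ = ∼-add₃
  ⊗-congʳ a ∼-scal = ∼-trans (∼-sym ∼-scal₁₂) ∼-scal₁₃

  ⊗-zeroˡ : ∀ xs → E.0ᴹ ⊗ xs ∼₃ []
  ⊗-zeroˡ []       = ∼-refl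
  ⊗-zeroˡ (x ∷ xs) = ∼-++ ∼-zero (⊗-zeroˡ xs)

  ⊗-distribʳ : ∀ a a' xs → (a E.+ᴹ a') ⊗ xs ∼₃ a ⊗ xs ++ a' ⊗ xs
  ⊗-distribʳ a a' []              = ∼-refl
  ⊗-distribʳ a a' ((e , w) ∷ xs) = begin
    ((a E.+ᴹ a' , e , w) ∷ []) ++ (a E.+ᴹ a') ⊗ xs
      ≈⟨ ∼-++ ∼-add₁ (⊗-distribʳ a a' xs) ⟩
    ((a , e , w) ∷ (a' , e , w) ∷ []) ++ (a ⊗ xs ++ a' ⊗ xs)
      ≈⟨ ++-interchange ((a , e , w) ∷ []) ((a' , e , w) ∷ []) (a ⊗ xs) (a' ⊗ xs) ⟩
    ((a , e , w) ∷ a ⊗ xs) ++ ((a' , e , w) ∷ a' ⊗ xs) ∎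

  ⊗-*ₗ : ∀ c a xs → (c E.*ₗ a) ⊗ xs ≡ c ⊙₃ a ⊗ xs
  ⊗-*ₗ c a xs = map-∘ xs

  ⊗-balance : ∀ c a xs → (c E.*ₗ a) ⊗ xs ∼₃ a ⊗ (c ⊙ xs)
  ⊗-balance c a []       = ∼-refl
  ⊗-balance c a (x ∷ xs) = ∼-++ ∼-scal₁₂ (⊗-balance c a xs)

  ₂₃-++ : ∀ g xs ys → (g ₂₃) (xs ++ ys) ≡ (g ₂₃) xs ++ (g ₂₃) ys
  ₂₃-++ g = concatMap-++ _

  ₂₃-⊙₃ : ∀ g c t → (g ₂₃) (c ⊙₃ t) ≡ c ⊙₃ (g ₂₃) t
  ₂₃-⊙₃ g c []                = refl
  ₂₃-⊙₃ g c ((a , b , v) ∷ t) =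
    ≡.trans (≡.cong₂ _++_ (⊗-*ₗ c a (g ((b , v) ∷ []))) (₂₃-⊙₃ g c t))
            (≡.sym (⊙₃-++ c (a ⊗ g ((b , v) ∷ [])) _))

  iter-suc : ∀ g k x → iter g k (g x) ≡ iter g (suc k) x
  iter-suc g zero    x = refl
  iter-suc g (suc k) x = ≡.cong g (iter-suc g k x)

  partialSum≡evalPoly : ∀ g P M x → partialSum P M g x ≡ evalPoly (applyUpTo P M) g x
  partialSum≡evalPoly g P zero    x = refl
  partialSum≡evalPoly g P (suc M) x = ≡.cong (P 0 ⊙ x ++_) (partialSum≡evalPoly g (P ∘ suc) M (g x))

  module _ (φ : LinearEndo) where
    open LinearEndo φ using ()
      renaming (fun to f; cong to f-cong; +-hom to f-+-hom; *-hom to f-*-hom)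

    f-[] : f [] ∼ []
    f-[] = ∼-trans (f-*-hom 0# []) (⊙-zeroˡ (f []))

    ₂₃-cong : ∀ {xs ys} → xs ∼₃ ys → (f ₂₃) xs ∼₃ (f ₂₃) ys
    ₂₃-cong ∼-refl = ∼-refl
    ₂₃-cong (∼-sym p) = ∼-sym (₂₃-cong p)
    ₂₃-cong (∼-trans p q) = ∼-trans (₂₃-cong p) (₂₃-cong q)
    ₂₃-cong (∼-++ {xs} {ys} {us} {ws} p q) = begin
      (f ₂₃) (xs ++ us)            ≡⟨ ₂₃-++ f xs us ⟩
      (f ₂₃) xs ++ (f ₂₃) us       ≈⟨ ∼-++ (₂₃-cong p) (₂₃-cong q) ⟩
      (f ₂₃) ys ++ (f ₂₃) ws       ≡⟨ ₂₃-++ f ys ws ⟨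
      (f ₂₃) (ys ++ ws)            ∎
    ₂₃-cong (∼-comm {xs} {ys}) = begin
      (f ₂₃) (xs ++ ys)            ≡⟨ ₂₃-++ f xs ys ⟩
      (f ₂₃) xs ++ (f ₂₃) ys       ≈⟨ ∼-comm {xs = (f ₂₃) xs} ⟩
      (f ₂₃) ys ++ (f ₂₃) xs       ≡⟨ ₂₃-++ f ys xs ⟨
      (f ₂₃) (ys ++ xs)            ∎
    ₂₃-cong (∼-pure {a' = a'} p q s) =
      ∼-++ (∼-trans (⊗-congˡ p _) (⊗-congʳ a' (f-cong (∼-pure q s)))) ∼-refl
    ₂₃-cong ∼-zero = ∼-++ (⊗-zeroˡ _) ∼-refl
    ₂₃-cong (∼-add₁ {a} {a'} {b} {v}) =
      ++-[]-split (a ⊗ f ((b , v) ∷ [])) _ (⊗-distribʳ a a' (f ((b , v) ∷ [])))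
    ₂₃-cong (∼-add₂ {a} {b} {b'} {v}) = ++-[]-split (a ⊗ f ((b , v) ∷ [])) _ (begin
      a ⊗ f ((b E.+ᴹ b' , v) ∷ [])              ≈⟨ ⊗-congʳ a (f-cong ∼-addˡ) ⟩
      a ⊗ f ((b , v) ∷ (b' , v) ∷ [])           ≈⟨ ⊗-congʳ a (f-+-hom ((b , v) ∷ []) _) ⟩
      a ⊗ (f ((b , v) ∷ []) ++ f ((b' , v) ∷ [])) ≡⟨ ⊗-++ a (f ((b , v) ∷ [])) _ ⟩
      a ⊗ f ((b , v) ∷ []) ++ a ⊗ f ((b' , v) ∷ []) ∎)
    ₂₃-cong (∼-add₃ {a} {b} {v} {v'}) = ++-[]-split (a ⊗ f ((b , v) ∷ [])) _ (begin
      a ⊗ f ((b , v V.+ᴹ v') ∷ [])              ≈⟨ ⊗-congʳ a (f-cong ∼-addʳ) ⟩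
      a ⊗ f ((b , v) ∷ (b , v') ∷ [])           ≈⟨ ⊗-congʳ a (f-+-hom ((b , v) ∷ []) _) ⟩
      a ⊗ (f ((b , v) ∷ []) ++ f ((b , v') ∷ [])) ≡⟨ ⊗-++ a (f ((b , v) ∷ [])) _ ⟩
      a ⊗ f ((b , v) ∷ []) ++ a ⊗ f ((b , v') ∷ []) ∎)
    ₂₃-cong (∼-scal₁₂ {c} {a} {b} {v}) =
      ∼-++ (∼-trans (⊗-balance c a _) (⊗-congʳ a (∼-sym (f-*-hom c ((b , v) ∷ []))))) ∼-refl
    ₂₃-cong (∼-scal₁₃ {c} {a} {b} {v}) =
      ∼-++ (∼-trans (⊗-balance c a _)
             (∼-trans (⊗-congʳ a (∼-sym (f-*-hom c ((b , v) ∷ [])))) (⊗-congʳ a (f-cong ∼-scal))))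
           ∼-refl

    ₂₃-linear : IsLinear₃ (f ₂₃)
    ₂₃-linear = record
      { cong  = ₂₃-cong
      ; +-hom = λ xs ys → ≡⇒∼₃ (₂₃-++ f xs ys)
      ; *-hom = λ c t → ≡⇒∼₃ (₂₃-⊙₃ f c t)
      }

    ₂₃-⊗ : ∀ a x → (f ₂₃) (a ⊗ x) ∼₃ a ⊗ f x
    ₂₃-⊗ a []      = ∼-sym (⊗-congʳ a f-[])
    ₂₃-⊗ a (p ∷ x) = begin
      a ⊗ f (p ∷ []) ++ (f ₂₃) (a ⊗ x)   ≈⟨ ∼-++ (∼-refl {xs = a ⊗ f (p ∷ [])}) (₂₃-⊗ a x) ⟩
      a ⊗ f (p ∷ []) ++ a ⊗ f x           ≡⟨ ⊗-++ a (f (p ∷ [])) (f x) ⟨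
      a ⊗ (f (p ∷ []) ++ f x)             ≈⟨ ⊗-congʳ a (f-+-hom (p ∷ []) x) ⟨
      a ⊗ f (p ∷ x)                       ∎

    evalPoly-⊗ : ∀ a cs x → a ⊗ evalPoly cs f x ∼₃ poly₃ cs (f ₂₃) (a ⊗ x)
    evalPoly-⊗ a []       x = ∼-refl
    evalPoly-⊗ a (c ∷ cs) x = begin
      a ⊗ (c ⊙ x ++ evalPoly cs f (f x))             ≡⟨ ⊗-++ a (c ⊙ x) _ ⟩
      a ⊗ (c ⊙ x) ++ a ⊗ evalPoly cs f (f x)         ≈⟨ ∼-++ (∼-sym (⊗-balance c a x)) (evalPoly-⊗ a cs (f x)) ⟩
      (c E.*ₗ a) ⊗ x ++ poly₃ cs (f ₂₃) (a ⊗ f x)    ≈⟨ ∼-++ (≡⇒∼₃ (⊗-*ₗ c a x))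
                                                          (cong (poly₃-linear cs ₂₃-linear) (∼-sym (₂₃-⊗ a x))) ⟩
      c ⊙₃ a ⊗ x ++ poly₃ cs (f ₂₃) ((f ₂₃) (a ⊗ x)) ∎

    evalPoly-₂₃ : ∀ cs t → (evalPoly cs f ₂₃) t ∼₃ poly₃ cs (f ₂₃) t
    evalPoly-₂₃ cs []                = ∼-sym ([]-hom (poly₃-linear cs ₂₃-linear))
    evalPoly-₂₃ cs ((a , b , v) ∷ t) = begin
      a ⊗ evalPoly cs f ((b , v) ∷ []) ++ (evalPoly cs f ₂₃) t
        ≈⟨ ∼-++ (evalPoly-⊗ a cs ((b , v) ∷ [])) (evalPoly-₂₃ cs t) ⟩
      poly₃ cs (f ₂₃) ((a , b , v) ∷ []) ++ poly₃ cs (f ₂₃) t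
        ≈⟨ +-hom (poly₃-linear cs ₂₃-linear) ((a , b , v) ∷ []) t ⟨
      poly₃ cs (f ₂₃) ((a , b , v) ∷ t) ∎

    evalPoly-₁₃ : ∀ cs t → (evalPoly cs f ₁₃) t ∼₃ poly₃ cs (f ₁₃) t
    evalPoly-₁₃ cs t = begin
      (evalPoly cs f ₁₃) t                        ≡⟨ ₁₃≡swap₁₂-₂₃-swap₁₂ (evalPoly cs f) t ⟩
      swap₁₂ ((evalPoly cs f ₂₃) (swap₁₂ t))      ≈⟨ swap₁₂-cong (evalPoly-₂₃ cs (swap₁₂ t)) ⟩
      swap₁₂ (poly₃ cs (f ₂₃) (swap₁₂ t))         ≈⟨ poly₃-swap₁₂-conj (₁₃≡swap₁₂-₂₃-swap₁₂ f) cs t ⟨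
      poly₃ cs (f ₁₃) t                           ∎

    treeCompatible-at : TreeCompatible f → ∀ g cs t →
      (g ₁₃) ((g ₂₃) t) ∼₃ poly₃ cs (f ₁₃) ((g ₂₃) t) →
      (g ₂₃) t ∼₃ poly₃ cs (f ₂₃) t →
      (g ₁₃) t ∼₃ poly₃ cs (f ₁₃) t →
      (g ₂₃) ((g ₁₃) t) ∼₃ poly₃ cs (f ₂₃) ((g ₁₃) t) →
      (g ₁₃) ((g ₂₃) t) ∼₃ (g ₂₃) ((g ₁₃) t)
    treeCompatible-at tc g cs t g₁₃∼ g₂₃∼ g₁₃∼′ g₂₃∼′ = begin
      (g ₁₃) ((g ₂₃) t)                      ≈⟨ g₁₃∼ ⟩
      poly₃ cs (f ₁₃) ((g ₂₃) t)             ≈⟨ cong (poly₃-linear cs ₁₃-linear-f) g₂₃∼ ⟩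
      poly₃ cs (f ₁₃) (poly₃ cs (f ₂₃) t)    ≈⟨ poly₃-poly₃-commute ₁₃-linear-f ₂₃-linear tc cs cs t ⟩
      poly₃ cs (f ₂₃) (poly₃ cs (f ₁₃) t)    ≈⟨ cong (poly₃-linear cs ₂₃-linear) g₁₃∼′ ⟨
      poly₃ cs (f ₂₃) ((g ₁₃) t)             ≈⟨ g₂₃∼′ ⟨
      (g ₂₃) ((g ₁₃) t)                      ∎
      where
        ₁₃-linear-f : IsLinear₃ (f ₁₃)
        ₁₃-linear-f = ₁₃-linear f ₂₃-linear

    evalPoly-treeCompatible : TreeCompatible f → ∀ cs → TreeCompatible (evalPoly cs f)
    evalPoly-treeCompatible tc cs t = treeCompatible-at tc (evalPoly cs f) cs t
      (evalPoly-₁₃ cs _) (evalPoly-₂₃ cs t) (evalPoly-₁₃ cs t) (evalPoly-₂₃ cs _)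

    partialSum-zero : ∀ P M x → x ∼ [] → partialSum P M f x ∼ []
    partialSum-zero P zero    x x∼[] = ∼-refl
    partialSum-zero P (suc M) x x∼[] =
      ∼-++ (⊙-cong (P 0) x∼[]) (partialSum-zero (P ∘ suc) M (f x) (∼-trans (f-cong x∼[]) f-[]))

    partialSum-stable : ∀ {N M} → N ≤ M → ∀ P x → iter f N x ∼ [] →
                        partialSum P M f x ∼ partialSum P N f x
    partialSum-stable {M = M} z≤n P x x∼[] = partialSum-zero P M x x∼[]
    partialSum-stable {suc N} (s≤s N≤M) P x fᴺ⁺¹x∼[] = ∼-++ ∼-refl
      (partialSum-stable N≤M (P ∘ suc) (f x) (∼-trans (≡⇒∼ (iter-suc f N x)) fᴺ⁺¹x∼[]))

    module _ (nil : LocallyNilpotent f) (P : ℕ → Carrier) where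

      index : T₂ → ℕ
      index x = proj₁ (nil x)

      evalSeries-truncate : ∀ M x → index x ≤ M →
                            evalSeries P f nil x ∼ evalPoly (applyUpTo P M) f x
      evalSeries-truncate M x index≤M = ∼-trans
        (∼-sym (partialSum-stable index≤M P x (proj₂ (proj₂ (nil x)))))
        (≡⇒∼ (partialSum≡evalPoly f P M x))

      index₂₃ : T₃ → ℕ
      index₂₃ []                = 0
      index₂₃ ((a , b , v) ∷ t) = index ((b , v) ∷ []) ⊔ index₂₃ t

      evalSeries-₂₃ : ∀ M t → index₂₃ t ≤ M →
                      (evalSeries P f nil ₂₃) t ∼₃ poly₃ (applyUpTo P M) (f ₂₃) t
      evalSeries-₂₃ M t index≤M = ∼-trans (truncate t index≤M) (evalPoly-₂₃ (applyUpTo P M) t)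
        where
          truncate : ∀ t → index₂₃ t ≤ M →
                     (evalSeries P f nil ₂₃) t ∼₃ (evalPoly (applyUpTo P M) f ₂₃) t
          truncate []                _  = ∼-refl
          truncate ((a , b , v) ∷ t) le = ∼-++
            (⊗-congʳ a (evalSeries-truncate M ((b , v) ∷ []) (m⊔n≤o⇒m≤o _ _ le)))
            (truncate t (m⊔n≤o⇒n≤o _ _ le))

      evalSeries-₁₃ : ∀ M t → index₂₃ (swap₁₂ t) ≤ M →
                      (evalSeries P f nil ₁₃) t ∼₃ poly₃ (applyUpTo P M) (f ₁₃) t
      evalSeries-₁₃ M t index≤M = begin
        (S ₁₃) t                          ≡⟨ ₁₃≡swap₁₂-₂₃-swap₁₂ S t ⟩
        swap₁₂ ((S ₂₃) (swap₁₂ t))        ≈⟨ swap₁₂-cong (evalSeries-₂₃ M (swap₁₂ t) index≤M) ⟩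
        swap₁₂ (poly₃ cs (f ₂₃) (swap₁₂ t)) ≈⟨ poly₃-swap₁₂-conj (₁₃≡swap₁₂-₂₃-swap₁₂ f) cs t ⟨
        poly₃ cs (f ₁₃) t                 ∎
        where
          S : T₂ → T₂
          S = evalSeries P f nil
          cs : List Carrier
          cs = applyUpTo P M

      -- Truncate P past the nilpotency indices of all pure tensors met on both sides of the identity.
      evalSeries-treeCompatible : TreeCompatible f → TreeCompatible (evalSeries P f nil)
      evalSeries-treeCompatible tc t = treeCompatible-at tc S (applyUpTo P M) t
        (evalSeries-₁₃ M _ (m⊔n≤o⇒m≤o i₁ i₂ (m⊔n≤o⇒m≤o (i₁ ⊔ i₂) (i₃ ⊔ i₄) ≤-refl)))
        (evalSeries-₂₃ M t (m⊔n≤o⇒n≤o i₁ i₂ (m⊔n≤o⇒m≤o (i₁ ⊔ i₂) (i₃ ⊔ i₄) ≤-refl)))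
        (evalSeries-₁₃ M t (m⊔n≤o⇒m≤o i₃ i₄ (m⊔n≤o⇒n≤o (i₁ ⊔ i₂) (i₃ ⊔ i₄) ≤-refl)))
        (evalSeries-₂₃ M _ (m⊔n≤o⇒n≤o i₃ i₄ (m⊔n≤o⇒n≤o (i₁ ⊔ i₂) (i₃ ⊔ i₄) ≤-refl)))
        where
          S : T₂ → T₂
          S = evalSeries P f nil
          i₁ i₂ i₃ i₄ M : ℕ
          i₁ = index₂₃ (swap₁₂ ((S ₂₃) t))
          i₂ = index₂₃ t
          i₃ = index₂₃ (swap₁₂ t)
          i₄ = index₂₃ ((S ₁₃) t)
          M = (i₁ ⊔ i₂) ⊔ (i₃ ⊔ i₄)

proposition2p4 : ∀ {r ℓr m ℓm n ℓn : Level}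
    (K : CommutativeRing r ℓr) → IsField K → CharZero K →
    (E : Module K m ℓm) (V : Module K n ℓn) →
    (φ : Tensor.LinearEndo K E V) →
    Tensor.TreeCompatible K E V (Tensor.LinearEndo.fun φ) →
    ((P : List (CommutativeRing.Carrier K)) →
      Tensor.TreeCompatible K E V (Tensor.evalPoly K E V P (Tensor.LinearEndo.fun φ)))
    × ((nil : Tensor.LocallyNilpotent K E V (Tensor.LinearEndo.fun φ)) →
       (P : ℕ → CommutativeRing.Carrier K) →
       Tensor.TreeCompatible K E V (Tensor.evalSeries K E V P (Tensor.LinearEndo.fun φ) nil))
proposition2p4 K _ _ E V φ tc =
  evalPoly-treeCompatible φ tc , λ nil P → evalSeries-treeCompatible φ nil P tc
  where open TreeCompatibility K E V
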